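{- Let $G$ be any graph without isolated vertices. If $f=(V_0,V_1,V_2)$ is a $\gamma_{qtR}(G)$-function and $V_{1,2}^*=\{v\in V_1 : N(v)\cap V_2\neq\emptyset\}$, then $$\gamma(G)+|V_2|+|V_{1,2}^*|\le \gamma_{qtR}(G)\le 3\gamma(G).$$
   Context: All graphs are finite, simple and undirected; $\gamma(G)$ is the domination number and $N(v)$ the open neighborhood. For $f:V(G)\to\{0,1,2\}$ write $V_i=\{v:f(v)=i\}$, $f=(V_0,V_1,V_2)$, weight $\sum_v f(v)$. A quasi-total Roman dominating function (QTRDF) is a function $f:V(G)\to\{0,1,2\}$ such that every vertex $u$ with $f(u)=0$ is adjacent to some $v$ with $f(v)=2$, and every vertex $x$ that is isolated in the subgraph induced by $V_1\cup V_2$ satisfies $f(x)=1$. $\gamma_{qtR}(G)$ is the minimum weight of a QTRDF on $G$; a $\gamma_{qtR}(G)$-function is a QTRDF of weight $\gamma_{qtR}(G)$. -}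

module Defs where

open import Data.Nat using (ℕ; _+_; _*_; _≤_)
open import Data.Bool using (Bool; true; false; T)
open import Data.Fin using (Fin; toℕ)
open import Data.Fin.Subset using (Subset; _∈_; ∣_∣)
open import Data.Fin.Properties using (any?)
open import Data.Vec using (allFin; tabulate; sum; count)
open import Data.Product using (∃; _×_; _,_)
open import Data.Sum using (_⊎_)
open import Relation.Binary.PropositionalEquality using (_≡_; _≢_)
open import Relation.Nullary using (Dec; ¬_)
open import Relation.Nullary.Decidable using (_×-dec_)
open import Data.Nat.Properties using () renaming (_≟_ to _≟ℕ_)
open import Data.Fin.Properties using () renaming (_≟_ to _≟F_)

record Graph (n : ℕ) : Set where
  field
    adj     : Fin n → Fin n → Bool
    sym     : ∀ u v → adj u v ≡ adj v u
    irrefl  : ∀ v → adj v v ≡ false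

open Graph public

Adj : ∀ {n} → Graph n → Fin n → Fin n → Set
Adj G u v = adj G u v ≡ true

Adj? : ∀ {n} (G : Graph n) u v → Dec (Adj G u v)
Adj? G u v = Data.Bool._≟_ (adj G u v) true
  where import Data.Bool

NoIsolated : ∀ {n} → Graph n → Set
NoIsolated {n} G = ∀ (v : Fin n) → ∃ λ u → Adj G v u

IsDominating : ∀ {n} → Graph n → Subset n → Set
IsDominating {n} G S = ∀ (v : Fin n) → v ∈ S ⊎ (∃ λ u → u ∈ S × Adj G v u)

IsDominationNumber : ∀ {n} → Graph n → ℕ → Set
IsDominationNumber {n} G d =
  (∃ λ S → IsDominating G S × ∣ S ∣ ≡ d) ×
  (∀ (S : Subset n) → IsDominating G S → d ≤ ∣ S ∣)

Labelling : ℕ → Set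
Labelling n = Fin n → Fin 3

val : ∀ {n} → Labelling n → Fin n → ℕ
val f v = toℕ (f v)

weight : ∀ {n} → Labelling n → ℕ
weight {n} f = sum (tabulate (val f))

IsQTRDF : ∀ {n} → Graph n → Labelling n → Set
IsQTRDF {n} G f =
  (∀ (u : Fin n) → val f u ≡ 0 → ∃ λ v → Adj G u v × val f v ≡ 2) ×
  -- x is isolated in the subgraph induced by V₁ ∪ V₂ ⇒ f(x) = 1
  (∀ (x : Fin n) → val f x ≢ 0 →
     (∀ (y : Fin n) → Adj G x y → val f y ≡ 0) → val f x ≡ 1)

IsMinQTRDF : ∀ {n} → Graph n → Labelling n → Set
IsMinQTRDF {n} G f = IsQTRDF G f × (∀ (g : Labelling n) → IsQTRDF G g → weight f ≤ weight g)

cardV2 : ∀ {n} → Labelling n → ℕ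
cardV2 {n} f = count (λ v → val f v ≟ℕ 2) (allFin n)

InV12* : ∀ {n} → Graph n → Labelling n → Fin n → Set
InV12* {n} G f v = val f v ≡ 1 × (∃ λ u → Adj G v u × val f u ≡ 2)

InV12*? : ∀ {n} (G : Graph n) (f : Labelling n) v → Dec (InV12* G f v)
InV12*? G f v = (val f v ≟ℕ 1) ×-dec any? (λ u → Adj? G v u ×-dec (val f u ≟ℕ 2))

cardV12* : ∀ {n} → Graph n → Labelling n → ℕ
cardV12* {n} G f = count (InV12*? G f) (allFin n)

-- Lower bound: S = V₂ ∪ (V₁ ∖ V*₁₂) is dominating (a vertex of V₀ or of V*₁₂ has a
-- neighbour in V₂), and every vertex v contributes exactly f(v) to |S| + |V₂| + |V*₁₂|,
-- so γ(G) + |V₂| + |V*₁₂| ≤ |S| + |V₂| + |V*₁₂| = w(f).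
-- Upper bound: for a γ(G)-set D pick a neighbour h(v) of every v ∈ D; labelling D by 2
-- and h(D) ∖ D by 1 is a QTRDF of weight at most 2|D| + |h(D)| ≤ 3γ(G).
module Submission where

open import Defs hiding (sym)
open import Data.Nat using (ℕ; zero; suc; _+_; _*_; _≤_; z≤n; s≤s)
open import Data.Nat.Properties
  using (≤-refl; ≤-trans; ≤-reflexive; +-mono-≤; +-monoˡ-≤; +-monoʳ-≤; +-suc; +-comm;
         +-commutativeSemigroup; *-zeroʳ; *-distribˡ-+; module ≤-Reasoning)
  renaming (_≟_ to _≟ℕ_)
open import Data.Bool using (Bool; true; false; if_then_else_)
import Data.Bool.Properties as Bool
open import Data.Fin using (Fin; zero; suc; toℕ)
open import Data.Fin.Subset using (Subset; _∈_; _∉_; ∣_∣; ⊥; ⁅_⁆; _∪_; inside; outside)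
open import Data.Fin.Subset.Properties using (_∈?_; ∣⊥∣≡0; ∣⁅x⁆∣≡1; ∣p∣≤∣x∷p∣; x∈⁅x⁆; x∈p∪q⁺)
open import Data.Vec using (_∷_; []; tabulate; sum; count; here; there)
open import Data.Vec.Properties using (lookup∘tabulate; lookup⇒[]=; tabulate-cong)
open import Data.Product using (∃; _×_; _,_; proj₁; proj₂)
open import Data.Sum using (_⊎_; inj₁; inj₂)
open import Function using (_∘_; id)
open import Relation.Binary.PropositionalEquality
open import Relation.Nullary using (Dec; yes; no; does; ¬_; contradiction)
open import Relation.Nullary.Decidable using (_×-dec_; _⊎-dec_; ¬?; dec-true; dec-false)
open import Relation.Unary using (Pred; Decidable)
open import Algebra.Properties.CommutativeSemigroup +-commutativeSemigroup using () renaming (interchange to +-interchange)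

𝟙 : Bool → ℕ
𝟙 b = if b then 1 else 0

∑ : ∀ {n} → (Fin n → ℕ) → ℕ
∑ f = sum (tabulate f)

∑-cong : ∀ {n} {f g : Fin n → ℕ} → (∀ i → f i ≡ g i) → ∑ f ≡ ∑ g
∑-cong f≗g = cong sum (tabulate-cong f≗g)

∑-mono-≤ : ∀ {n} {f g : Fin n → ℕ} → (∀ i → f i ≤ g i) → ∑ f ≤ ∑ g
∑-mono-≤ {zero}  f≤g = z≤n
∑-mono-≤ {suc n} f≤g = +-mono-≤ (f≤g zero) (∑-mono-≤ (f≤g ∘ suc))

∑-distrib-+ : ∀ {n} (f g : Fin n → ℕ) → ∑ (λ i → f i + g i) ≡ ∑ f + ∑ g
∑-distrib-+ {zero}  f g = refl
∑-distrib-+ {suc n} f g =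
  trans (cong (f zero + g zero +_) (∑-distrib-+ (f ∘ suc) (g ∘ suc))) (+-interchange (f zero) (g zero) _ _)

∑-distribˡ-* : ∀ {n} (c : ℕ) (f : Fin n → ℕ) → ∑ (λ i → c * f i) ≡ c * ∑ f
∑-distribˡ-* {zero}  c f = sym (*-zeroʳ c)
∑-distribˡ-* {suc n} c f =
  trans (cong (c * f zero +_) (∑-distribˡ-* c (f ∘ suc))) (sym (*-distribˡ-+ c (f zero) _))

count-tabulate : ∀ {a p n} {A : Set a} {P : Pred A p} (P? : Decidable P) (g : Fin n → A) →
                 count P? (tabulate g) ≡ ∑ (λ i → 𝟙 (does (P? (g i))))
count-tabulate {n = zero}  P? g = refl
count-tabulate {n = suc n} P? g with does (P? (g zero))
... | true  = cong suc (count-tabulate P? (g ∘ suc))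
... | false = count-tabulate P? (g ∘ suc)

∣p∣≡∑∈ : ∀ {n} (p : Subset n) → ∣ p ∣ ≡ ∑ (λ i → 𝟙 (does (i ∈? p)))
∣p∣≡∑∈ []            = refl
∣p∣≡∑∈ (inside  ∷ p) = cong suc (∣p∣≡∑∈ p)
∣p∣≡∑∈ (outside ∷ p) = ∣p∣≡∑∈ p

∣p∪q∣≤∣p∣+∣q∣ : ∀ {n} (p q : Subset n) → ∣ p ∪ q ∣ ≤ ∣ p ∣ + ∣ q ∣
∣p∪q∣≤∣p∣+∣q∣ []            []            = z≤n
∣p∪q∣≤∣p∣+∣q∣ (inside  ∷ p) (x       ∷ q) =
  s≤s (≤-trans (∣p∪q∣≤∣p∣+∣q∣ p q) (+-monoʳ-≤ ∣ p ∣ (∣p∣≤∣x∷p∣ x q)))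
∣p∪q∣≤∣p∣+∣q∣ (outside ∷ p) (inside  ∷ q) =
  ≤-trans (s≤s (∣p∪q∣≤∣p∣+∣q∣ p q)) (≤-reflexive (sym (+-suc ∣ p ∣ ∣ q ∣)))
∣p∪q∣≤∣p∣+∣q∣ (outside ∷ p) (outside ∷ q) = ∣p∪q∣≤∣p∣+∣q∣ p q

subset : ∀ {p n} {P : Pred (Fin n) p} → Decidable P → Subset n
subset P? = tabulate (does ∘ P?)

∈-subset⁺ : ∀ {p n} {P : Pred (Fin n) p} (P? : Decidable P) {i} → P i → i ∈ subset P?
∈-subset⁺ P? {i} Pi = lookup⇒[]= i (subset P?) (trans (lookup∘tabulate (does ∘ P?) i) (dec-true (P? i) Pi))

∣subset∣ : ∀ {p n} {P : Pred (Fin n) p} (P? : Decidable P) → ∣ subset P? ∣ ≡ ∑ (λ i → 𝟙 (does (P? i)))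
∣subset∣ P? = trans (count-tabulate (Bool._≟ inside) (does ∘ P?)) (∑-cong (λ i → cong 𝟙 (does-≟true (does (P? i)))))
  where
  does-≟true : ∀ b → does (b Bool.≟ true) ≡ b
  does-≟true true  = refl
  does-≟true false = refl

image : ∀ {m n} → (Fin m → Fin n) → Subset m → Subset n
image h []            = ⊥
image h (inside  ∷ p) = ⁅ h zero ⁆ ∪ image (h ∘ suc) p
image h (outside ∷ p) = image (h ∘ suc) p

∈-image⁺ : ∀ {m n} (h : Fin m → Fin n) {p : Subset m} {i} → i ∈ p → h i ∈ image h p
∈-image⁺ h               here        = x∈p∪q⁺ (inj₁ (x∈⁅x⁆ (h zero)))
∈-image⁺ h {inside  ∷ p} (there i∈p) = x∈p∪q⁺ (inj₂ (∈-image⁺ (h ∘ suc) i∈p))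
∈-image⁺ h {outside ∷ p} (there i∈p) = ∈-image⁺ (h ∘ suc) i∈p

∣image∣≤∣p∣ : ∀ {m n} (h : Fin m → Fin n) (p : Subset m) → ∣ image h p ∣ ≤ ∣ p ∣
∣image∣≤∣p∣ {n = n} h [] = ≤-reflexive (∣⊥∣≡0 n)
∣image∣≤∣p∣ h (inside ∷ p) = begin
  ∣ ⁅ h zero ⁆ ∪ image (h ∘ suc) p ∣        ≤⟨ ∣p∪q∣≤∣p∣+∣q∣ ⁅ h zero ⁆ (image (h ∘ suc) p) ⟩
  ∣ ⁅ h zero ⁆ ∣ + ∣ image (h ∘ suc) p ∣    ≡⟨ cong (_+ ∣ image (h ∘ suc) p ∣) (∣⁅x⁆∣≡1 (h zero)) ⟩
  suc ∣ image (h ∘ suc) p ∣                 ≤⟨ s≤s (∣image∣≤∣p∣ (h ∘ suc) p) ⟩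
  suc ∣ p ∣                                 ∎
  where open ≤-Reasoning
∣image∣≤∣p∣ h (outside ∷ p) = ∣image∣≤∣p∣ (h ∘ suc) p

vertex-contribution : ∀ {c} {C : Set c} (x : Fin 3) (C? : Dec C) → (C → toℕ x ≡ 1) →
                      𝟙 (does ((toℕ x ≟ℕ 2) ⊎-dec ((toℕ x ≟ℕ 1) ×-dec ¬? C?))) + 𝟙 (does (toℕ x ≟ℕ 2)) + 𝟙 (does C?)
                      ≡ toℕ x
vertex-contribution zero             (yes c) C⇒1 = contradiction (C⇒1 c) λ ()
vertex-contribution zero             (no _)  C⇒1 = refl
vertex-contribution (suc zero)       (yes _) C⇒1 = refl
vertex-contribution (suc zero)       (no _)  C⇒1 = refl
vertex-contribution (suc (suc zero)) (yes c) C⇒1 = contradiction (C⇒1 c) λ ()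
vertex-contribution (suc (suc zero)) (no _)  C⇒1 = refl

module _ {n} (G : Graph n) (f : Labelling n) where

  InV₂∪V₁∖V*₁₂? : Decidable (λ v → val f v ≡ 2 ⊎ (val f v ≡ 1 × ¬ InV12* G f v))
  InV₂∪V₁∖V*₁₂? v = (val f v ≟ℕ 2) ⊎-dec ((val f v ≟ℕ 1) ×-dec ¬? (InV12*? G f v))

  V₂∪V₁∖V*₁₂ : Subset n
  V₂∪V₁∖V*₁₂ = subset InV₂∪V₁∖V*₁₂?

  V₂∪V₁∖V*₁₂-dominating : (∀ u → val f u ≡ 0 → ∃ λ v → Adj G u v × val f v ≡ 2) →
                           IsDominating G V₂∪V₁∖V*₁₂
  V₂∪V₁∖V*₁₂-dominating roman v with f v in fv
  ... | zero = let (u , v~u , fu≡2) = roman v (cong toℕ fv) in inj₂ (u , ∈-subset⁺ InV₂∪V₁∖V*₁₂? (inj₁ fu≡2) , v~u)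
  ... | suc (suc zero) = inj₁ (∈-subset⁺ InV₂∪V₁∖V*₁₂? (inj₁ (cong toℕ fv)))
  ... | suc zero with InV12*? G f v
  ...   | yes (_ , u , v~u , fu≡2) = inj₂ (u , ∈-subset⁺ InV₂∪V₁∖V*₁₂? (inj₁ fu≡2) , v~u)
  ...   | no v∉V*₁₂               = inj₁ (∈-subset⁺ InV₂∪V₁∖V*₁₂? (inj₂ (cong toℕ fv , v∉V*₁₂)))

  weight≡∣V₂∪V₁∖V*₁₂∣+∣V₂∣+∣V*₁₂∣ : weight f ≡ ∣ V₂∪V₁∖V*₁₂ ∣ + cardV2 f + cardV12* G f
  weight≡∣V₂∪V₁∖V*₁₂∣+∣V₂∣+∣V*₁₂∣ = begin
    ∑ (val f)                            ≡⟨ ∑-cong (λ v → sym (vertex-contribution (f v) (InV12*? G f v) proj₁)) ⟩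
    ∑ (λ v → inS v + inV₂ v + inV*₁₂ v)  ≡⟨ ∑-distrib-+ (λ v → inS v + inV₂ v) inV*₁₂ ⟩
    ∑ (λ v → inS v + inV₂ v) + ∑ inV*₁₂  ≡⟨ cong (_+ ∑ inV*₁₂) (∑-distrib-+ inS inV₂) ⟩
    ∑ inS + ∑ inV₂ + ∑ inV*₁₂            ≡⟨ sym (cong₂ _+_ (cong₂ _+_ (∣subset∣ InV₂∪V₁∖V*₁₂?) (count-tabulate (λ v → val f v ≟ℕ 2) id))
                                                            (count-tabulate (InV12*? G f) id)) ⟩
    ∣ V₂∪V₁∖V*₁₂ ∣ + cardV2 f + cardV12* G f ∎
    where
    open ≡-Reasoning
    inS inV₂ inV*₁₂ : Fin n → ℕ
    inS v = 𝟙 (does (InV₂∪V₁∖V*₁₂? v))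
    inV₂ v = 𝟙 (does (val f v ≟ℕ 2))
    inV*₁₂ v = 𝟙 (does (InV12*? G f v))

label : Bool → Bool → Fin 3
label true  _     = suc (suc zero)
label false true  = suc zero
label false false = zero

label-≤ : ∀ a b → toℕ (label a b) ≤ 2 * 𝟙 a + 𝟙 b
label-≤ true  b     = +-monoʳ-≤ 2 z≤n
label-≤ false true  = ≤-refl
label-≤ false false = ≤-refl

label-≡0 : ∀ a b → toℕ (label a b) ≡ 0 → b ≡ false
label-≡0 false false _ = refl

label-≡1 : ∀ a b → a ≡ false → toℕ (label a b) ≢ 0 → toℕ (label a b) ≡ 1
label-≡1 false true  _ _    = refl
label-≡1 false false _ l≢0 = contradiction refl l≢0

module _ {n} (V₂ V₁ : Subset n) where

  labelling : Labelling n
  labelling x = label (does (x ∈? V₂)) (does (x ∈? V₁))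

  labelling-≡2 : ∀ {x} → x ∈ V₂ → val labelling x ≡ 2
  labelling-≡2 {x} x∈V₂ = cong (λ a → toℕ (label a (does (x ∈? V₁)))) (dec-true (x ∈? V₂) x∈V₂)

  labelling-≢0 : ∀ {x} → x ∈ V₁ → val labelling x ≢ 0
  labelling-≢0 {x} x∈V₁ gx≡0 = contradiction (trans (sym (dec-true (x ∈? V₁) x∈V₁)) (label-≡0 _ _ gx≡0)) λ ()

  labelling-≡1 : ∀ {x} → x ∉ V₂ → val labelling x ≢ 0 → val labelling x ≡ 1
  labelling-≡1 {x} x∉V₂ = label-≡1 _ _ (dec-false (x ∈? V₂) x∉V₂)

  weight-labelling : weight labelling ≤ 2 * ∣ V₂ ∣ + ∣ V₁ ∣
  weight-labelling = begin
    ∑ (val labelling)                ≤⟨ ∑-mono-≤ (λ x → label-≤ (does (x ∈? V₂)) (does (x ∈? V₁))) ⟩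
    ∑ (λ x → 2 * in₂ x + in₁ x)      ≡⟨ ∑-distrib-+ (λ x → 2 * in₂ x) in₁ ⟩
    ∑ (λ x → 2 * in₂ x) + ∑ in₁      ≡⟨ cong (_+ ∑ in₁) (∑-distribˡ-* 2 in₂) ⟩
    2 * ∑ in₂ + ∑ in₁                ≡⟨ sym (cong₂ (λ a b → 2 * a + b) (∣p∣≡∑∈ V₂) (∣p∣≡∑∈ V₁)) ⟩
    2 * ∣ V₂ ∣ + ∣ V₁ ∣              ∎
    where
    open ≤-Reasoning
    in₂ in₁ : Fin n → ℕ
    in₂ x = 𝟙 (does (x ∈? V₂))
    in₁ x = 𝟙 (does (x ∈? V₁))

  labelling-isQTRDF : (G : Graph n) → IsDominating G V₂ → (∀ v → v ∈ V₂ → ∃ λ u → Adj G v u × u ∈ V₁) →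
                      IsQTRDF G labelling
  labelling-isQTRDF G V₂-dominating V₂-partnered = roman , quasiTotal
    where
    roman : ∀ u → val labelling u ≡ 0 → ∃ λ v → Adj G u v × val labelling v ≡ 2
    roman u gu≡0 with V₂-dominating u
    ... | inj₁ u∈V₂             = contradiction (trans (sym (labelling-≡2 u∈V₂)) gu≡0) λ ()
    ... | inj₂ (v , v∈V₂ , u~v) = v , u~v , labelling-≡2 v∈V₂
    quasiTotal : ∀ x → val labelling x ≢ 0 → (∀ y → Adj G x y → val labelling y ≡ 0) → val labelling x ≡ 1
    quasiTotal x gx≢0 isolated = byMembership (x ∈? V₂)
      where
      byMembership : Dec (x ∈ V₂) → val labelling x ≡ 1
      byMembership (yes x∈V₂) = let (u , x~u , u∈V₁) = V₂-partnered x x∈V₂ in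
                                contradiction (isolated u x~u) (labelling-≢0 u∈V₁)
      byMembership (no  x∉V₂) = labelling-≡1 x∉V₂ gx≢0

dominating⇒QTRDF≤3∣D∣ : ∀ {n} (G : Graph n) → NoIsolated G → ∀ {D} → IsDominating G D →
                         ∃ λ g → IsQTRDF G g × weight g ≤ 3 * ∣ D ∣
dominating⇒QTRDF≤3∣D∣ G noIsolated {D} D-dominating =
  labelling D (image h D) ,
  labelling-isQTRDF D (image h D) G D-dominating (λ v v∈D → h v , proj₂ (noIsolated v) , ∈-image⁺ h v∈D) ,
  (begin
    weight (labelling D (image h D))  ≤⟨ weight-labelling D (image h D) ⟩
    2 * ∣ D ∣ + ∣ image h D ∣          ≤⟨ +-monoʳ-≤ (2 * ∣ D ∣) (∣image∣≤∣p∣ h D) ⟩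
    2 * ∣ D ∣ + ∣ D ∣                  ≡⟨ +-comm (2 * ∣ D ∣) ∣ D ∣ ⟩
    3 * ∣ D ∣                          ∎)
  where
  open ≤-Reasoning
  h : Fin _ → Fin _
  h = proj₁ ∘ noIsolated

mainTheorem3 : ∀ (n : ℕ) (G : Graph n) → NoIsolated G →
    ∀ (f : Labelling n) → IsMinQTRDF G f →
    ∀ (d : ℕ) → IsDominationNumber G d →
    (d + cardV2 f + cardV12* G f ≤ weight f) × (weight f ≤ 3 * d)
mainTheorem3 n G noIsolated f (f-QTRDF , f-minimal) d ((D , D-dominating , ∣D∣≡d) , d-minimal) =
  lowerBound , upperBound
  where
  open ≤-Reasoning
  lowerBound : d + cardV2 f + cardV12* G f ≤ weight f
  lowerBound = begin
    d + cardV2 f + cardV12* G f                   ≤⟨ +-monoˡ-≤ _ (+-monoˡ-≤ _ γ≤∣S∣) ⟩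
    ∣ V₂∪V₁∖V*₁₂ G f ∣ + cardV2 f + cardV12* G f  ≡⟨ sym (weight≡∣V₂∪V₁∖V*₁₂∣+∣V₂∣+∣V*₁₂∣ G f) ⟩
    weight f                                      ∎
    where
    γ≤∣S∣ : d ≤ ∣ V₂∪V₁∖V*₁₂ G f ∣
    γ≤∣S∣ = d-minimal (V₂∪V₁∖V*₁₂ G f) (V₂∪V₁∖V*₁₂-dominating G f (proj₁ f-QTRDF))
  upperBound : weight f ≤ 3 * d
  upperBound = let (g , g-QTRDF , g≤3∣D∣) = dominating⇒QTRDF≤3∣D∣ G noIsolated D-dominating in begin
    weight f   ≤⟨ f-minimal g g-QTRDF ⟩
    weight g   ≤⟨ g≤3∣D∣ ⟩
    3 * ∣ D ∣  ≡⟨ cong (3 *_) ∣D∣≡d ⟩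
    3 * d      ∎
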